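{- Let $k\ge1$, $n\ge1$, and for $\ell\in\{0,1,\dots,k\}$ let $h(\ell)=k\sum_{i=k-\ell+1}^{k}\alpha_i$, where $\alpha_1=1$ and $\alpha_i=1+(i-1)\alpha_{i-1}$. For configurations $p,q\in[n]^k$ let $\phi(p,q)=h(d_H(p,q))$, where $d_H(p,q)=|\{i:p_i\ne q_i\}|$ is the Hamming distance. Consider a run of an algorithm and an adversary on a request sequence $r^1,\dots,r^T\in[n]^k$, where $q^t$ and $\mathcal{A}^t$ denote the configurations in $[n]^k$ of the algorithm and of the adversary after serving $r^t$ (and $q^0=\mathcal{A}^0$ is the common initial configuration). Then for every $t\in\{1,\dots,T\}$, $$\phi(q^{t-1},\mathcal{A}^t)-\phi(q^{t-1},\mathcal{A}^{t-1})\le k\cdot\alpha_k\cdot d_H(\mathcal{A}^t,\mathcal{A}^{t-1}).$$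
   Context: Configurations in $[n]^k$ represent positions of $k$ servers, the $i$-th one in a uniform metric space $M_i$ with point set $[n]$. -}

module Defs where

open import Data.Nat using (ℕ; zero; suc; _+_; _*_; _∸_)
open import Data.Fin using (Fin)
open import Data.Fin.Properties using (_≟_)
open import Data.List using (List; map; upTo; filter; length)
open import Data.Nat.ListAction using (sum)
open import Data.List.Base using ()
open import Data.Fin.Base using ()
open import Relation.Nullary.Decidable using (¬?)

Config : ℕ → ℕ → Set
Config n k = Fin k → Fin n

-- α_1 = 1, α_i = 1 + (i-1) α_{i-1}  (α 0 is an unused dummy value 0).
α : ℕ → ℕ
α zero = zero
α (suc zero) = 1
α (suc (suc i)) = 1 + suc i * α (suc i)

-- Σ_{i=a}^{b} f i  (empty, i.e. 0, when b < a)
sumFromTo : (ℕ → ℕ) → ℕ → ℕ → ℕ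
sumFromTo f a b = sum (map (λ j → f (a + j)) (upTo (suc b ∸ a)))

h : ℕ → ℕ → ℕ
h k ℓ = k * sumFromTo α (suc (k ∸ ℓ)) k

open import Data.List using (allFin) public

dH : ∀ {n k} → Config n k → Config n k → ℕ
dH {n} {k} p q = length (filter (λ i → ¬? (p i ≟ q i)) (allFin k))

φ : ∀ {n k} → Config n k → Config n k → ℕ
φ {n} {k} p q = h k (dH p q)

-- The potential h(ℓ) grows by k·α_{k-ℓ} ≤ k·α_k from ℓ to ℓ + 1 (and stays constant from ℓ = k on),
-- so it is monotone with increments bounded by k·α_k. Moving the adversary from A^{t-1} to A^t
-- changes the Hamming distance to q^{t-1} by at most d_H(A^t, A^{t-1}) (triangle inequality),
-- hence changes φ by at most k·α_k·d_H(A^t, A^{t-1}).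
module Submission where

open import Defs
open import Data.Nat using (ℕ; _+_; _*_; _≤_; _∸_)
open import Data.Fin using (Fin)
open import Data.Product using (∃)
open import Relation.Binary.PropositionalEquality using (_≡_)

open import Data.Nat using (zero; suc; z≤n; s≤s; pred; _≤′_; ≤′-refl; ≤′-step)
open import Data.Nat.Properties
  using (≤-refl; ≤-trans; ≤-reflexive; ≤⇒≤′; n≤1+n; m≤m+n; m∸n≤m; +-mono-≤; +-monoˡ-≤; +-monoʳ-≤;
         *-monoʳ-≤; +-identityʳ; +-assoc; +-comm; +-suc; *-zeroʳ; *-suc; *-distribˡ-+;
         +-∸-assoc; pred[m∸n]≡m∸[1+n]; module ≤-Reasoning)
open import Data.List using ([]; _∷_; map; upTo; applyUpTo; filter; length)
open import Data.List.Properties using (map-upTo; map-∘; map-cong; filter-accept)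
open import Data.Nat.ListAction using (sum)
open import Data.Fin.Properties using (_≟_)
open import Data.Sum using (_⊎_; inj₁; inj₂)
open import Function using (_∘_)
open import Relation.Nullary using (¬_; yes; no)
open import Relation.Nullary.Decidable using (¬?)
open import Relation.Unary using (Pred; Decidable)
open import Relation.Binary.PropositionalEquality using (sym; trans; cong; cong₂; module ≡-Reasoning)

monotone-from-step : (f : ℕ → ℕ) → (∀ n → f n ≤ f (suc n)) → ∀ {m n} → m ≤ n → f m ≤ f n
monotone-from-step f step m≤n = go (≤⇒≤′ m≤n)
  where
  go : ∀ {m n} → m ≤′ n → f m ≤ f n
  go ≤′-refl       = ≤-refl
  go (≤′-step m≤n) = ≤-trans (go m≤n) (step _)

bounded-step⇒+-≤ : (f : ℕ → ℕ) (c : ℕ) → (∀ n → f (suc n) ≤ f n + c) → ∀ m d → f (m + d) ≤ f m + c * d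
bounded-step⇒+-≤ f c step m zero = ≤-reflexive (begin
  f (m + 0)   ≡⟨ cong f (+-identityʳ m) ⟩
  f m         ≡⟨ sym (+-identityʳ (f m)) ⟩
  f m + 0     ≡⟨ cong (f m +_) (sym (*-zeroʳ c)) ⟩
  f m + c * 0 ∎)
  where open ≡-Reasoning
bounded-step⇒+-≤ f c step m (suc d) = begin
  f (m + suc d)         ≡⟨ cong f (+-suc m d) ⟩
  f (suc (m + d))       ≤⟨ step (m + d) ⟩
  f (m + d) + c         ≤⟨ +-monoˡ-≤ c (bounded-step⇒+-≤ f c step m d) ⟩
  f m + c * d + c       ≡⟨ +-assoc (f m) (c * d) c ⟩
  f m + (c * d + c)     ≡⟨ cong (f m +_) (+-comm (c * d) c) ⟩
  f m + (c + c * d)     ≡⟨ cong (f m +_) (sym (*-suc c d)) ⟩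
  f m + c * suc d       ∎
  where open ≤-Reasoning

α-mono : ∀ {i j} → i ≤ j → α i ≤ α j
α-mono = monotone-from-step α α-≤-suc
  where
  α-≤-suc : ∀ i → α i ≤ α (suc i)
  α-≤-suc zero    = z≤n
  α-≤-suc (suc i) = ≤-trans (m≤m+n (α (suc i)) (i * α (suc i))) (n≤1+n _)

sumFromTo-peel : ∀ f {a b} → a ≤ b → sumFromTo f a b ≡ f a + sumFromTo f (suc a) b
sumFromTo-peel f {a} {b} a≤b = begin
  sumFromTo f a b                                 ≡⟨ cong (λ m → sum (map F (upTo m))) (+-∸-assoc 1 a≤b) ⟩
  F 0 + sum (map F (applyUpTo suc (b ∸ a)))       ≡⟨ cong (λ xs → F 0 + sum (map F xs)) (sym (map-upTo suc (b ∸ a))) ⟩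
  F 0 + sum (map F (map suc (upTo (b ∸ a))))      ≡⟨ cong (λ xs → F 0 + sum xs) (sym (map-∘ (upTo (b ∸ a)))) ⟩
  F 0 + sum (map (F ∘ suc) (upTo (b ∸ a)))        ≡⟨ cong₂ _+_ (cong f (+-identityʳ a)) (cong sum (map-cong (cong f ∘ +-suc a) (upTo (b ∸ a)))) ⟩
  f a + sumFromTo f (suc a) b                     ∎
  where
  open ≡-Reasoning
  F : ℕ → ℕ
  F j = f (a + j)

-- Uniform in ℓ thanks to the dummy value α 0 = 0: for ℓ ≥ k both sides have k ∸ ℓ = 0 and h is constant.
h-suc : ∀ k ℓ → h k (suc ℓ) ≡ h k ℓ + k * α (k ∸ ℓ)
h-suc k ℓ = trans (cong (λ m → k * sumFromTo α (suc m) k) (sym (pred[m∸n]≡m∸[1+n] k ℓ)))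
                  (peel (k ∸ ℓ) (m∸n≤m k ℓ))
  where
  peel : ∀ m → m ≤ k → k * sumFromTo α (suc (pred m)) k ≡ k * sumFromTo α (suc m) k + k * α m
  peel zero    _   = sym (trans (cong (k * sumFromTo α 1 k +_) (*-zeroʳ k)) (+-identityʳ _))
  peel (suc m) m<k = trans (cong (k *_) (sumFromTo-peel α m<k))
                           (trans (*-distribˡ-+ k (α (suc m)) _) (+-comm (k * α (suc m)) _))

h-mono : ∀ k {ℓ ℓ′} → ℓ ≤ ℓ′ → h k ℓ ≤ h k ℓ′
h-mono k = monotone-from-step (h k) (λ ℓ → ≤-trans (m≤m+n _ _) (≤-reflexive (sym (h-suc k ℓ))))

h-suc-≤ : ∀ k ℓ → h k (suc ℓ) ≤ h k ℓ + k * α k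
h-suc-≤ k ℓ = ≤-trans (≤-reflexive (h-suc k ℓ))
                      (+-monoʳ-≤ (h k ℓ) (*-monoʳ-≤ k (α-mono (m∸n≤m k ℓ))))

h-+-≤ : ∀ k ℓ d → h k (ℓ + d) ≤ h k ℓ + k * α k * d
h-+-≤ k = bounded-step⇒+-≤ (h k) (k * α k) (h-suc-≤ k)

length-filter-≤-∷ : ∀ {a p} {A : Set a} {P : Pred A p} (P? : Decidable P) x xs
  → length (filter P? xs) ≤ length (filter P? (x ∷ xs))
length-filter-≤-∷ P? x xs with P? x
... | yes _ = n≤1+n _
... | no _  = ≤-refl

length-filter-≤-+ : ∀ {a p} {A : Set a} {P Q R : Pred A p} (P? : Decidable P) (Q? : Decidable Q) (R? : Decidable R)
  → (∀ {x} → P x → Q x ⊎ R x)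
  → ∀ xs → length (filter P? xs) ≤ length (filter Q? xs) + length (filter R? xs)
length-filter-≤-+ P? Q? R? P⇒Q∪R [] = ≤-refl
length-filter-≤-+ P? Q? R? P⇒Q∪R (x ∷ xs) with P? x | length-filter-≤-+ P? Q? R? P⇒Q∪R xs
... | no _   | ih = ≤-trans ih (+-mono-≤ (length-filter-≤-∷ Q? x xs) (length-filter-≤-∷ R? x xs))
... | yes px | ih with P⇒Q∪R px
...   | inj₁ qx rewrite filter-accept Q? {xs = xs} qx =
  s≤s (≤-trans ih (+-monoʳ-≤ _ (length-filter-≤-∷ R? x xs)))
...   | inj₂ rx rewrite filter-accept R? {xs = xs} rx =
  ≤-trans (s≤s (≤-trans ih (+-monoˡ-≤ _ (length-filter-≤-∷ Q? x xs)))) (≤-reflexive (sym (+-suc _ _)))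

dH-triangle : ∀ {n k} (p a b : Config n k) → dH p a ≤ dH p b + dH a b
dH-triangle {k = k} p a b =
  length-filter-≤-+ (λ i → ¬? (p i ≟ a i)) (λ i → ¬? (p i ≟ b i)) (λ i → ¬? (a i ≟ b i)) split (allFin k)
  where
  split : ∀ {i} → ¬ p i ≡ a i → ¬ p i ≡ b i ⊎ ¬ a i ≡ b i
  split {i} p≢a with p i ≟ b i
  ... | yes p≡b = inj₂ (λ a≡b → p≢a (trans p≡b (sym a≡b)))
  ... | no p≢b  = inj₁ p≢b

lemma1 : (k n : ℕ) → 1 ≤ k → 1 ≤ n → (T : ℕ)
    → (r q A : ℕ → Config n k)
    → q 0 ≡ A 0
    → (∀ t → 1 ≤ t → t ≤ T → ∃ λ (i : Fin k) → q t i ≡ r t i)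
    → (∀ t → 1 ≤ t → t ≤ T → ∃ λ (i : Fin k) → A t i ≡ r t i)
    → ∀ t → 1 ≤ t → t ≤ T
    → φ (q (t ∸ 1)) (A t)
      ≤ φ (q (t ∸ 1)) (A (t ∸ 1)) + k * α k * dH (A t) (A (t ∸ 1))
-- The bound holds for any three configurations.
lemma1 k n _ _ T r q A _ _ _ t _ _ = begin
  h k (dH p a)                    ≤⟨ h-mono k (dH-triangle p a b) ⟩
  h k (dH p b + dH a b)           ≤⟨ h-+-≤ k (dH p b) (dH a b) ⟩
  h k (dH p b) + k * α k * dH a b ∎
  where
  open ≤-Reasoning
  p a b : Config n k
  p = q (t ∸ 1)
  a = A t
  b = A (t ∸ 1)
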